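{- Let $k\ge 2$ and let $T$ be a $k$-cut search tree on an $n$-node tree $S$. Then $T$ can be transformed into a $(k-1)$-cut search tree on $S$ with at most $n-k$ rotations, such that each intermediate tree is a $k$-cut tree.
   Context: A search tree on an unrooted tree $S$ (STT) is a rooted tree $T$ with $V(T)=V(S)$ defined recursively: the root $r$ is any node of $S$, and the subtrees of $T$ rooted at the children of $r$ are search trees on the connected components of $S\setminus r$. $T_x$ is the subtree of $T$ rooted at $x$; $\delta(T_x)$ is the set of nodes outside $V(T_x)$ adjacent in $S$ to a node of $V(T_x)$. $T$ is a $k$-cut tree if $|\delta(T_x)|\le k$ for all $x$. A rotation at a node $q$ with parent $p$: $q$ and $p$ swap places; if $q$ has a child $y$ whose subtree contains a node adjacent to $p$ in $S$, then $y$ becomes a child of $p$; all other children keep their parents. -}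

module Defs where

open import Data.Nat using (ℕ; zero; suc; _≤_; _∸_)
open import Data.Fin using (Fin)
open import Data.Maybe using (Maybe; just; nothing)
open import Data.List using (List; length)
open import Data.List.Membership.Propositional using (_∈_)
open import Data.Product using (Σ; ∃; _×_; _,_)
open import Data.Sum using (_⊎_)
open import Data.Unit using (⊤)
open import Relation.Nullary using (¬_)
open import Relation.Binary.PropositionalEquality using (_≡_; _≢_)

Adj : {n : ℕ} → List (Fin n × Fin n) → Fin n → Fin n → Set
Adj E x y = ((x , y) ∈ E) ⊎ ((y , x) ∈ E)

data Walk {n : ℕ} (E : List (Fin n × Fin n)) (C : Fin n → Set) : Fin n → Fin n → Set where
  here : ∀ {x} → C x → Walk E C x x
  cons : ∀ {x y z} → C x → Adj E x y → Walk E C y z → Walk E C x z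

Connected : {n : ℕ} → List (Fin n × Fin n) → (Fin n → Set) → Set
Connected E C = ∀ x y → C x → C y → Walk E C x y

IsTree : {n : ℕ} → List (Fin n × Fin n) → Set
IsTree {n} E = Connected E (λ _ → ⊤) × (length E ≡ n ∸ 1)

IsComponent : {n : ℕ} → List (Fin n × Fin n) → (Fin n → Set) → (Fin n → Set) → Set
IsComponent E W C =
  (∀ x → C x → W x) × (∃ λ x → C x) × Connected E C ×
  (∀ x y → C x → W y → Adj E x y → C y)

-- A rooted tree T on V(S) = Fin n, represented by its parent function
-- (nothing = no parent, i.e. the root).
Parent : ℕ → Set
Parent n = Fin n → Maybe (Fin n)

anc : {n : ℕ} → Parent n → ℕ → Fin n → Maybe (Fin n)
anc p zero x = just x
anc p (suc m) x with p x
... | nothing = nothing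
... | just z = anc p m z

InSub : {n : ℕ} → Parent n → Fin n → Fin n → Set
InSub p y x = ∃ λ m → anc p m x ≡ just y

-- STT E p U r : the subtree T_r of T (parent function p) is a search tree
-- on the vertex set U, with root r (recursive definition of the paper):
-- r ∈ U, V(T_r) = U, and for every child c of r, V(T_c) is a connected
-- component of U \ r and T_c is a search tree on it.
data STT {n : ℕ} (E : List (Fin n × Fin n)) (p : Parent n)
         : (Fin n → Set) → Fin n → Set₁ where
  node : ∀ {U r} →
         U r →
         (∀ x → (U x → InSub p r x) × (InSub p r x → U x)) →
         (∀ c → p c ≡ just r →
            IsComponent E (λ x → U x × x ≢ r) (InSub p c) ×
            STT E p (InSub p c) c) →
         STT E p U r

IsSTT : {n : ℕ} → List (Fin n × Fin n) → Parent n → Set₁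
IsSTT E p = ∃ λ r → (p r ≡ nothing) × STT E p (λ _ → ⊤) r

δ : {n : ℕ} → List (Fin n × Fin n) → Parent n → Fin n → Fin n → Set
δ E p x y = ¬ InSub p x y × (∃ λ z → InSub p x z × Adj E z y)

AtMost : {n : ℕ} → ℕ → (Fin n → Set) → Set
AtMost {n} k P = Σ (List (Fin n)) λ xs → (length xs ≤ k) × (∀ x → P x → x ∈ xs)

KCut : {n : ℕ} → List (Fin n × Fin n) → ℕ → Parent n → Set
KCut E k p = ∀ x → AtMost k (δ E p x)

-- Rotation p ⟶ p' at node q with parent a (a is "p" in the paper).
Rotation : {n : ℕ} → List (Fin n × Fin n) → Parent n → Parent n → Set
Rotation {n} E p p' = Σ (Fin n) λ q → Σ (Fin n) λ a →
  (p q ≡ just a) ×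
  (p' a ≡ just q) ×
  (p' q ≡ p a) ×
  (∀ y → p y ≡ just q →
     ((∃ λ z → InSub p y z × Adj E z a) → p' y ≡ just a) ×
     (¬ (∃ λ z → InSub p y z × Adj E z a) → p' y ≡ just q)) ×
  (∀ z → z ≢ q → z ≢ a → p z ≢ just q → p' z ≡ p z)

data RotSeq {n : ℕ} (E : List (Fin n × Fin n)) (P : Parent n → Set₁)
     : Parent n → Parent n → ℕ → Set₁ where
  done : ∀ {t} → P t → RotSeq E P t t 0
  step : ∀ {t t' t'' m} → P t → Rotation E t t' → RotSeq E P t' t'' m →
         RotSeq E P t t'' (suc m)

-- Call v bad when |δ(T_v)| = k. If x is bad and its parent a is not, rotate at
-- x. Then T′_x = T_a, so x becomes good, and every subtree other than T′_a is
-- unchanged. Since δ(T_x) ⊆ {a} ∪ δ(T_a) and |δ(T_x)| > |δ(T_a)|, δ(T_a) lies in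
-- δ(T_x); using that S is a tree (each child subtree has a unique edge to its
-- parent) one gets δ(T′_a) ⊆ {x} ∪ (δ(T_y) ∖ {x, a}) for the unique child y of
-- x that moves to a, so |δ(T′_a)| ≤ k - 1 and a stays good. Each rotation thus
-- removes exactly one bad node. Finally, δ(T_x) of a topmost bad node x consists
-- of k good ancestors of x, so there are at most n - k bad nodes.

module Submission where

open import Defs
open import Data.Nat using (ℕ; zero; suc; _+_; _≤_; _<_; _∸_; z≤n; s≤s; _≤?_; _<?_; _⊔_)
open import Data.Nat.Properties
open import Data.Fin using (Fin; zero; suc) renaming (_≟_ to _≟F_)
open import Data.Fin.Properties using (any?) renaming (suc-injective to fsuc-injective)
open import Data.Maybe using (Maybe; just; nothing)
open import Data.Maybe.Properties using (just-injective) renaming (≡-dec to ≡-decM)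
open import Data.List using (List; []; _∷_; length; map)
open import Data.List.Properties using (length-map; length-removeAt′)
open import Data.List.Membership.Propositional using (_∈_)
open import Data.List.Membership.Propositional.Properties using (∈-map⁺)
open import Data.List.Relation.Unary.Any using (here; there; _─_; index)
import Data.List.Relation.Unary.Any as Any
open import Data.Product using (Σ; ∃; _×_; _,_; proj₁; proj₂; uncurry)
open import Data.Product.Properties using () renaming (≡-dec to ≡-decP)
open import Data.Sum using (_⊎_; inj₁; inj₂)
open import Data.Unit using (⊤; tt)
open import Data.Empty using (⊥; ⊥-elim)
open import Relation.Nullary using (¬_; Dec; yes; no)
open import Relation.Nullary.Decidable using (_×-dec_; _⊎-dec_; ¬?)
open import Level using (0ℓ)
open import Relation.Unary using (Pred; Decidable; _⊆_; _≐_)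
open import Relation.Unary.Properties using (_∪?_; ∁?)
open import Relation.Binary.PropositionalEquality

nothing≢just : ∀ {A : Set} {x : A} → nothing ≢ just x
nothing≢just ()

just-unique : ∀ {A : Set} {u w : A} {m : Maybe A} → m ≡ just u → m ≡ just w → u ≡ w
just-unique e1 e2 = just-injective (trans (sym e1) e2)

module Ancestry {n : ℕ} (p : Parent n) where

  anc-suc : ∀ m x w → p x ≡ just w → anc p (suc m) x ≡ anc p m w
  anc-suc m x w e with p x
  anc-suc m x w refl | just .w = refl

  anc-+ : ∀ i j x y → anc p i x ≡ just y → anc p (i + j) x ≡ anc p j y
  anc-+ zero j x .x refl = refl
  anc-+ (suc i) j x y e with p x
  ... | nothing = ⊥-elim (nothing≢just e)
  ... | just w = anc-+ i j w y e

  anc-last-step : ∀ m z v → anc p (suc m) z ≡ just v → ∃ λ c → anc p m z ≡ just c × p c ≡ just v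
  anc-last-step zero z v e with p z in eq
  ... | nothing = ⊥-elim (nothing≢just e)
  ... | just w = z , refl , trans eq e
  anc-last-step (suc m) z v e with p z in eq
  ... | nothing = ⊥-elim (nothing≢just e)
  ... | just w = anc-last-step m w v e

  InSub-refl : ∀ x → InSub p x x
  InSub-refl x = 0 , refl

  InSub-step : ∀ {v w z} → InSub p v w → p z ≡ just w → InSub p v z
  InSub-step {v} {w} {z} (m , e) pz = suc m , trans (anc-suc m z w pz) e

  InSub-child : ∀ {v c} → p c ≡ just v → InSub p v c
  InSub-child {v} = InSub-step (InSub-refl v)

  InSub-trans : ∀ {u v z} → InSub p u v → InSub p v z → InSub p u z
  InSub-trans {u} {v} {z} (i , e1) (j , e2) = j + i , trans (anc-+ j i z v e2) e1

  child-toward : ∀ {v z} → InSub p v z → z ≢ v → ∃ λ c → p c ≡ just v × InSub p c z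
  child-toward (zero , refl) z≢v = ⊥-elim (z≢v refl)
  child-toward {v} {z} (suc m , e) _ with anc-last-step m z v e
  ... | c , e1 , e2 = c , e2 , m , e1

  parent-inside : ∀ {v z} → InSub p v z → z ≢ v → ∃ λ w → p z ≡ just w × InSub p v w
  parent-inside (zero , refl) z≢v = ⊥-elim (z≢v refl)
  parent-inside {v} {z} (suc m , e) _ with p z
  ... | nothing = ⊥-elim (nothing≢just e)
  ... | just w = w , refl , m , e

  InSub-parent : ∀ {v z w} → InSub p v z → z ≢ v → p z ≡ just w → InSub p v w
  InSub-parent vz z≢v pz with parent-inside vz z≢v
  ... | w , e , vw with trans (sym pz) e
  ... | refl = vw

  InSub-ind : ∀ {v} (P : Fin n → Set) → P v →
              (∀ z w → p z ≡ just w → InSub p v w → P w → P z) →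
              ∀ z → InSub p v z → P z
  InSub-ind {v} P Pv closed z (m , e) = go m z e
    where
    go : ∀ m z → anc p m z ≡ just v → P z
    go zero z refl = Pv
    go (suc m) z e with p z in eq
    ... | nothing = ⊥-elim (nothing≢just e)
    ... | just w = closed z w eq (m , e) (go m w e)

  anc-beyond-root : ∀ {R} → p R ≡ nothing → ∀ t → anc p (suc t) R ≡ nothing
  anc-beyond-root {R} pR t with p R
  anc-beyond-root {R} refl t | nothing = refl

  module Rooted (R : Fin n) (pR : p R ≡ nothing) (reach : ∀ z → InSub p R z) where

    acyclic : ∀ {c v} → p c ≡ just v → ¬ InSub p c v
    acyclic {c} {v} pc cv = from-root (reach c)
      where
      ancestors-inside : ∀ j z → InSub p c z → ∃ λ w → anc p j z ≡ just w × InSub p c w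
      ancestors-inside zero z cz = z , refl , cz
      ancestors-inside (suc j) z cz with z ≟F c
      ... | yes refl with ancestors-inside j v cv
      ...   | w , e , cw = w , trans (anc-suc j z v pc) e , cw
      ancestors-inside (suc j) z cz | no z≢c with parent-inside cz z≢c
      ... | w , e , cw with ancestors-inside j w cw
      ...   | w' , e' , cw' = w' , trans (anc-suc j z w e) e' , cw'
      from-root : ¬ InSub p R c
      from-root (d , e) with ancestors-inside d c (InSub-refl c)
      ... | w , e' , cw with trans (sym e') e
      ... | refl with R ≟F c
      ...   | yes refl = nothing≢just (trans (sym pR) pc)
      ...   | no R≢c with parent-inside cw R≢c
      ...     | _ , pR' , _ = nothing≢just (trans (sym pR) pR')

    InSub-antisym : ∀ {v z} → InSub p v z → InSub p z v → v ≡ z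
    InSub-antisym {v} {z} vz zv with v ≟F z
    ... | yes v≡z = v≡z
    ... | no v≢z with parent-inside vz (λ e → v≢z (sym e))
    ... | w , e , vw = ⊥-elim (acyclic e (InSub-trans zv vw))

    ancestors-comparable : ∀ {u v z} → InSub p u z → InSub p v z → InSub p u v ⊎ InSub p v u
    ancestors-comparable {u} {v} {z} (i , e1) (j , e2) with ≤-total i j
    ... | inj₁ i≤j with m≤n⇒∃[o]m+o≡n i≤j
    ...   | t , refl = inj₂ (t , trans (sym (anc-+ i t z u e1)) e2)
    ancestors-comparable {u} {v} {z} (i , e1) (j , e2) | inj₂ j≤i with m≤n⇒∃[o]m+o≡n j≤i
    ...   | t , refl = inj₁ (t , trans (sym (anc-+ j t z v e2)) e1)

    child-toward-unique : ∀ {c1 c2 v z} → p c1 ≡ just v → p c2 ≡ just v →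
                          InSub p c1 z → InSub p c2 z → c1 ≡ c2
    child-toward-unique {c1} {c2} p1 p2 h1 h2 with ancestors-comparable h1 h2
    ... | inj₁ c1c2 with c2 ≟F c1
    ...   | yes e = sym e
    ...   | no ne = ⊥-elim (acyclic p1 (InSub-parent c1c2 ne p2))
    child-toward-unique {c1} {c2} p1 p2 h1 h2 | inj₂ c2c1 with c1 ≟F c2
    ...   | yes e = e
    ...   | no ne = ⊥-elim (acyclic p2 (InSub-parent c2c1 ne p1))

    depth : Fin n → ℕ
    depth z = proj₁ (reach z)

    depth-bound : ∀ {m z v} → anc p m z ≡ just v → m ≤ depth z
    depth-bound {m} {z} e with m ≤? depth z
    ... | yes m≤d = m≤d
    ... | no m≰d with m≤n⇒∃[o]m+o≡n (≰⇒> m≰d)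
    ... | t , eq = ⊥-elim (nothing≢just (begin
          nothing                        ≡⟨ sym (anc-beyond-root pR t) ⟩
          anc p (suc t) R                ≡⟨ sym (anc-+ (depth z) (suc t) z R (proj₂ (reach z))) ⟩
          anc p (depth z + suc t) z      ≡⟨ cong (λ k → anc p k z) (trans (+-suc _ t) eq) ⟩
          anc p m z                      ≡⟨ e ⟩
          just _                         ∎))
      where open ≡-Reasoning

    InSub? : ∀ v z → Dec (InSub p v z)
    InSub? v z with anyUpTo? (λ m → ≡-decM _≟F_ (anc p m z) (just v)) (suc (depth z))
    ... | yes (m , _ , e) = yes (m , e)
    ... | no none = no λ { (m , e) → none (m , s≤s (depth-bound e) , e) }

∈-─ : ∀ {A : Set} {x y : A} (xs : List A) (x∈xs : x ∈ xs) → y ∈ xs → y ≢ x → y ∈ (xs ─ x∈xs)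
∈-─ (a ∷ xs) (here refl) (here refl) y≢x = ⊥-elim (y≢x refl)
∈-─ (a ∷ xs) (here refl) (there y∈xs) _ = y∈xs
∈-─ (a ∷ xs) (there _) (here e) _ = here e
∈-─ (a ∷ xs) (there x∈xs) (there y∈xs) y≢x = there (∈-─ xs x∈xs y∈xs y≢x)

edges-≢ : ∀ {A : Set} {e₁ e₂ : A × A} {z₁ z₂ u : A} → (e₁ ≡ (z₁ , u) ⊎ e₁ ≡ (u , z₁)) →
          (e₂ ≡ (z₂ , u) ⊎ e₂ ≡ (u , z₂)) → z₁ ≢ z₂ → z₁ ≢ u → z₂ ≢ u → e₁ ≢ e₂
edges-≢ (inj₁ refl) (inj₁ refl) z₁≢z₂ _ _ e = z₁≢z₂ (cong proj₁ e)
edges-≢ (inj₁ refl) (inj₂ refl) _ z₁≢u _ e = z₁≢u (cong proj₁ e)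
edges-≢ (inj₂ refl) (inj₁ refl) _ _ z₂≢u e = z₂≢u (sym (cong proj₁ e))
edges-≢ (inj₂ refl) (inj₂ refl) z₁≢z₂ _ _ e = z₁≢z₂ (cong proj₂ e)

δ-≐ : ∀ {n} {E : List (Fin n × Fin n)} {p q : Parent n} {v w} →
      InSub p v ≐ InSub q w → δ E p v ≐ δ E q w
δ-≐ (pv⊆qw , qw⊆pv) =
  (λ (¬vy , z , vz , adj) → (λ wy → ¬vy (qw⊆pv wy)) , z , pv⊆qw vz , adj) ,
  (λ (¬wy , z , wz , adj) → (λ vy → ¬wy (pv⊆qw vy)) , z , qw⊆pv wz , adj)

module Counting where

  tail? : ∀ {n} {P : Pred (Fin (suc n)) 0ℓ} → Decidable P → Decidable (λ i → P (suc i))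
  tail? P? i = P? (suc i)

  count : ∀ {n} {P : Pred (Fin n) 0ℓ} → Decidable P → ℕ
  count {zero} P? = 0
  count {suc n} P? with P? zero
  ... | yes _ = suc (count (tail? P?))
  ... | no _ = count (tail? P?)

  count-mono : ∀ {n} {P Q : Pred (Fin n) 0ℓ} (P? : Decidable P) (Q? : Decidable Q) →
               P ⊆ Q → count P? ≤ count Q?
  count-mono {zero} P? Q? P⊆Q = z≤n
  count-mono {suc n} P? Q? P⊆Q with P? zero | Q? zero
  ... | yes P0 | no ¬Q0 = ⊥-elim (¬Q0 (P⊆Q P0))
  ... | yes _ | yes _ = s≤s (count-mono (tail? P?) (tail? Q?) P⊆Q)
  ... | no _ | yes _ = m≤n⇒m≤1+n (count-mono (tail? P?) (tail? Q?) P⊆Q)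
  ... | no _ | no _ = count-mono (tail? P?) (tail? Q?) P⊆Q

  count-ext : ∀ {n} {P Q : Pred (Fin n) 0ℓ} (P? : Decidable P) (Q? : Decidable Q) →
              P ≐ Q → count P? ≡ count Q?
  count-ext P? Q? (P⊆Q , Q⊆P) = ≤-antisym (count-mono P? Q? P⊆Q) (count-mono Q? P? Q⊆P)

  count-none : ∀ {n} {P : Pred (Fin n) 0ℓ} (P? : Decidable P) → (∀ i → ¬ P i) → count P? ≡ 0
  count-none {zero} P? none = refl
  count-none {suc n} P? none with P? zero
  ... | yes P0 = ⊥-elim (none zero P0)
  ... | no _ = count-none (tail? P?) (λ i → none (suc i))

  count-pos : ∀ {n} {P : Pred (Fin n) 0ℓ} (P? : Decidable P) → 0 < count P? → ∃ P
  count-pos P? 0<c with any? P?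
  ... | yes found = found
  ... | no none = ⊥-elim (<-irrefl (sym (count-none P? (λ i Pi → none (i , Pi)))) 0<c)

  remove? : ∀ {n} {P : Pred (Fin n) 0ℓ} → Decidable P → (i : Fin n) → Decidable (λ j → P j × j ≢ i)
  remove? P? i j = P? j ×-dec ¬? (j ≟F i)

  remove?-suc : ∀ {n} {P : Pred (Fin (suc n)) 0ℓ} (P? : Decidable P) (i : Fin n) →
                count (remove? (tail? P?) i) ≡ count (λ j → remove? P? (suc i) (suc j))
  remove?-suc P? i = count-ext (remove? (tail? P?) i) (λ j → remove? P? (suc i) (suc j))
    ( (λ (Pj , j≢i) → Pj , λ e → j≢i (fsuc-injective e))
    , (λ (Pj , sj≢si) → Pj , λ e → sj≢si (cong suc e)) )

  count-remove : ∀ {n} {P : Pred (Fin n) 0ℓ} (P? : Decidable P) {i} → P i →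
                 count P? ≡ suc (count (remove? P? i))
  count-remove {suc n} P? {zero} Pi with P? zero | remove? P? zero zero
  ... | no ¬P0 | _ = ⊥-elim (¬P0 Pi)
  ... | yes _ | yes (_ , 0≢0) = ⊥-elim (0≢0 refl)
  ... | yes _ | no _ = cong suc (count-ext (tail? P?) (tail? (remove? P? zero)) ((λ P0 → P0 , λ ()) , proj₁))
  count-remove {suc n} P? {suc i} Pi with P? zero | remove? P? (suc i) zero
  ... | yes P0 | no ¬R0 = ⊥-elim (¬R0 (P0 , λ ()))
  ... | no ¬P0 | yes R0 = ⊥-elim (¬P0 (proj₁ R0))
  ... | yes _ | yes _ = cong suc (trans (count-remove (tail? P?) Pi) (cong suc (remove?-suc P? i)))
  ... | no _ | no _ = trans (count-remove (tail? P?) Pi) (cong suc (remove?-suc P? i))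

  count-singleton : ∀ {n} (i : Fin n) → count (_≟F i) ≡ 1
  count-singleton i = trans (count-remove (_≟F i) refl)
                            (cong suc (count-none (remove? (_≟F i) i) (λ j (j≡i , j≢i) → j≢i j≡i)))

  count-∪ : ∀ {n} {P Q : Pred (Fin n) 0ℓ} (P? : Decidable P) (Q? : Decidable Q) →
            count (P? ∪? Q?) ≤ count P? + count Q?
  count-∪ {zero} P? Q? = z≤n
  count-∪ {suc n} P? Q? with P? zero | Q? zero
  ... | yes _ | yes _ = s≤s (≤-trans (count-∪ (tail? P?) (tail? Q?)) (+-monoʳ-≤ (count (tail? P?)) (n≤1+n _)))
  ... | yes _ | no _ = s≤s (count-∪ (tail? P?) (tail? Q?))
  ... | no _ | yes _ = ≤-trans (s≤s (count-∪ (tail? P?) (tail? Q?))) (≤-reflexive (sym (+-suc _ _)))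
  ... | no _ | no _ = count-∪ (tail? P?) (tail? Q?)

  count-compl : ∀ {n} {P : Pred (Fin n) 0ℓ} (P? : Decidable P) → count P? + count (∁? P?) ≡ n
  count-compl {zero} P? = refl
  count-compl {suc n} P? with P? zero
  ... | yes _ = cong suc (count-compl (tail? P?))
  ... | no _ = trans (+-suc _ _) (cong suc (count-compl (tail? P?)))

  _∈?_ : ∀ {n} (i : Fin n) (xs : List (Fin n)) → Dec (i ∈ xs)
  i ∈? xs = Any.any? (i ≟F_) xs

  count-list : ∀ {n} (xs : List (Fin n)) → count (_∈? xs) ≤ length xs
  count-list {n} [] = ≤-reflexive (count-none {n} (_∈? []) (λ i ()))
  count-list (x ∷ xs) = begin
    count (_∈? (x ∷ xs))          ≤⟨ count-mono (_∈? (x ∷ xs)) ((_≟F x) ∪? (_∈? xs)) head-or-tail ⟩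
    count ((_≟F x) ∪? (_∈? xs))   ≤⟨ count-∪ (_≟F x) (_∈? xs) ⟩
    count (_≟F x) + count (_∈? xs)   ≤⟨ +-mono-≤ (≤-reflexive (count-singleton x)) (count-list xs) ⟩
    suc (length xs)                                   ∎
    where
    open ≤-Reasoning
    head-or-tail : ∀ {i} → i ∈ x ∷ xs → i ≡ x ⊎ i ∈ xs
    head-or-tail (here e) = inj₁ e
    head-or-tail (there m) = inj₂ m

  AtMost-count : ∀ {n} {P : Pred (Fin n) 0ℓ} (P? : Decidable P) → AtMost (count P?) P
  AtMost-count {zero} P? = [] , z≤n , λ ()
  AtMost-count {suc n} P? with P? zero | AtMost-count (tail? P?)
  ... | yes _ | xs , len , cover =
    zero ∷ map suc xs , s≤s (≤-trans (≤-reflexive (length-map suc xs)) len) ,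
    λ { zero _ → here refl ; (suc i) Pi → there (∈-map⁺ suc (cover i Pi)) }
  ... | no ¬P0 | xs , len , cover =
    map suc xs , ≤-trans (≤-reflexive (length-map suc xs)) len ,
    λ { zero P0 → ⊥-elim (¬P0 P0) ; (suc i) Pi → ∈-map⁺ suc (cover i Pi) }

  count≤⇒AtMost : ∀ {n k} {P : Pred (Fin n) 0ℓ} (P? : Decidable P) → count P? ≤ k → AtMost k P
  count≤⇒AtMost P? c≤k with AtMost-count P?
  ... | xs , len , cover = xs , ≤-trans len c≤k , cover

  AtMost⇒count≤ : ∀ {n k} {P : Pred (Fin n) 0ℓ} (P? : Decidable P) → AtMost k P → count P? ≤ k
  AtMost⇒count≤ P? (xs , len , cover) =
    ≤-trans (count-mono P? _ (λ {i} → cover i)) (≤-trans (count-list xs) len)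

module Graph {n : ℕ} (E : List (Fin n × Fin n)) where

  Adj-sym : ∀ {x y} → Adj E x y → Adj E y x
  Adj-sym (inj₁ a) = inj₂ a
  Adj-sym (inj₂ a) = inj₁ a

  Adj? : ∀ x y → Dec (Adj E x y)
  Adj? x y = Any.any? (≡-decP _≟F_ _≟F_ (x , y)) E ⊎-dec Any.any? (≡-decP _≟F_ _≟F_ (y , x)) E

  Adj⇒edge : ∀ {z u} → Adj E z u → ∃ λ e → e ∈ E × (e ≡ (z , u) ⊎ e ≡ (u , z))
  Adj⇒edge (inj₁ zu∈E) = _ , zu∈E , inj₁ refl
  Adj⇒edge (inj₂ uz∈E) = _ , uz∈E , inj₂ refl

  walk-start : ∀ {C x y} → Walk E C x y → C x
  walk-start (here c) = c
  walk-start (cons c _ _) = c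

  walk-mono : ∀ {C D : Pred (Fin n) 0ℓ} {x y} → C ⊆ D → Walk E C x y → Walk E D x y
  walk-mono C⊆D (here c) = here (C⊆D c)
  walk-mono C⊆D (cons c a w) = cons (C⊆D c) a (walk-mono C⊆D w)

  walk-++ : ∀ {C x y z} → Walk E C x y → Walk E C y z → Walk E C x z
  walk-++ (here _) w' = w'
  walk-++ (cons c a w) w' = cons c a (walk-++ w w')

  walk-reverse : ∀ {C x y} → Walk E C x y → Walk E C y x
  walk-reverse (here c) = here c
  walk-reverse (cons c a w) = walk-++ (walk-reverse w) (cons (walk-start w) (Adj-sym a) (here c))

  walk-exit : ∀ {C D : Pred (Fin n) 0ℓ} {x r} → Walk E C x r → D x → ¬ D r →
              (∀ a b → D a → C b → b ≢ r → Adj E a b → D b) → ∃ λ z → D z × Adj E z r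
  walk-exit (here _) Dx ¬Dr closed = ⊥-elim (¬Dr Dx)
  walk-exit {x = x} {r = r} (cons {y = y} _ a w) Dx ¬Dr closed with y ≟F r
  ... | yes refl = x , Dx , a
  ... | no y≢r = walk-exit w (closed _ _ Dx (walk-start w) y≢r a) ¬Dr closed

-- A non-recursive characterisation of IsSTT, valid when S is connected.
record SearchTree {n : ℕ} (E : List (Fin n × Fin n)) (p : Parent n) : Set where
  field
    root : Fin n
    root-parent : p root ≡ nothing
    reach : ∀ z → InSub p root z
    hook : ∀ c r → p c ≡ just r → ∃ λ z → InSub p c z × Adj E z r
    edge-comparable : ∀ u w → Adj E u w → InSub p u w ⊎ InSub p w u

module FromIsSTT {n : ℕ} {E : List (Fin n × Fin n)} {p : Parent n} {R : Fin n}
                 (S-connected : Connected E (λ _ → ⊤)) (T : STT E p (λ _ → ⊤) R) where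
  open Graph E
  open Ancestry p

  STT-vertices : ∀ {U r} → STT E p U r → ∀ x → (U x → InSub p r x) × (InSub p r x → U x)
  STT-vertices (node _ vertices _) = vertices

  STT-children : ∀ {U r} → STT E p U r → ∀ c → p c ≡ just r →
                 IsComponent E (λ x → U x × x ≢ r) (InSub p c) × STT E p (InSub p c) c
  STT-children (node _ _ children) = children

  reach : ∀ z → InSub p R z
  reach z = proj₁ (STT-vertices T z) tt

  STT-at : ∀ m {U r v} → STT E p U r → anc p m v ≡ just r → ∃ λ U' → STT E p U' v
  STT-at zero {U} Tr refl = U , Tr
  STT-at (suc m) Tr e with anc-last-step m _ _ e
  ... | c , e1 , pc = STT-at m (proj₂ (STT-children Tr c pc)) e1

  connected-below : ∀ m {U r v} → STT E p U r → anc p m v ≡ just r → v ≢ r →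
                    Connected E (InSub p v)
  connected-below zero Tr refl v≢r = ⊥-elim (v≢r refl)
  connected-below (suc m) {v = v} Tr e _ with anc-last-step m _ _ e
  ... | c , e1 , pc with v ≟F c
  ...   | yes refl = proj₁ (proj₂ (proj₂ (proj₁ (STT-children Tr c pc))))
  ...   | no v≢c = connected-below m (proj₂ (STT-children Tr c pc)) e1 v≢c

  subtree-connected : ∀ v → Connected E (InSub p v)
  subtree-connected v with v ≟F R
  ... | yes refl = λ x y _ _ → walk-mono (λ {z} _ → reach z) (S-connected x y tt tt)
  ... | no v≢R = connected-below (proj₁ (reach v)) T (proj₂ (reach v)) v≢R

  hook : ∀ c r → p c ≡ just r → ∃ λ z → InSub p c z × Adj E z r
  hook c r pc with STT-at (proj₁ (reach r)) T (proj₂ (reach r))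
  ... | U , Tr with STT-children Tr c pc
  ... | (inside , _ , _ , closed) , _ =
    walk-exit (subtree-connected r c r (InSub-child pc) (InSub-refl r)) (InSub-refl c)
              (λ cr → proj₂ (inside r cr) refl)
              (λ a b ca rb b≢r adj → closed a b ca (proj₂ (STT-vertices Tr b) rb , b≢r) adj)

  edge-below : ∀ m {U r u w} → STT E p U r → anc p m u ≡ just r → U w → Adj E u w →
               InSub p u w ⊎ InSub p w u
  edge-below m {r = r} {u} {w} Tr e Uw adj with u ≟F r | w ≟F r
  ... | yes refl | _ = inj₁ (proj₁ (STT-vertices Tr w) Uw)
  ... | no _ | yes refl = inj₂ (m , e)
  edge-below zero Tr refl Uw adj | no u≢r | no _ = ⊥-elim (u≢r refl)
  edge-below (suc m) Tr e Uw adj | no _ | no w≢r with anc-last-step m _ _ e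
  ... | c , e1 , pc with STT-children Tr c pc
  ... | (_ , _ , _ , closed) , Tc = edge-below m Tc e1 (closed _ _ (m , e1) (Uw , w≢r) adj) adj

  edge-comparable : ∀ u w → Adj E u w → InSub p u w ⊎ InSub p w u
  edge-comparable u w = edge-below (proj₁ (reach u)) T (proj₂ (reach u)) tt

IsSTT⇒SearchTree : ∀ {n} {E : List (Fin n × Fin n)} {p : Parent n} →
                   Connected E (λ _ → ⊤) → IsSTT E p → SearchTree E p
IsSTT⇒SearchTree S-connected (R , pR , T) = record
  { root = R ; root-parent = pR ; reach = reach ; hook = hook ; edge-comparable = edge-comparable }
  where open FromIsSTT S-connected T

max-over : ∀ {m} → (Fin m → ℕ) → ℕ
max-over {zero} f = 0
max-over {suc m} f = f zero ⊔ max-over (λ i → f (suc i))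

≤-max-over : ∀ {m} (f : Fin m → ℕ) i → f i ≤ max-over f
≤-max-over f zero = m≤m⊔n _ _
≤-max-over f (suc i) = ≤-trans (≤-max-over (λ i → f (suc i)) i) (m≤n⊔m _ _)

module SearchTreeTheory {n : ℕ} {E : List (Fin n × Fin n)} {p : Parent n} (T : SearchTree E p) where
  open SearchTree T public
  open Ancestry p public
  open Rooted root root-parent reach public
  open Graph E
  open Counting

  HeightAtMost : ℕ → Fin n → Set
  HeightAtMost h v = ∀ z m → anc p m z ≡ just v → m ≤ h

  height-child : ∀ {h v c} → HeightAtMost (suc h) v → p c ≡ just v → HeightAtMost h c
  height-child {h} {v} {c} hv pc z m e = ≤-pred (begin
    suc m    ≡⟨ +-comm 1 m ⟩
    m + 1    ≤⟨ hv z (m + 1) (trans (anc-+ m 1 z c e) (anc-suc 0 c v pc)) ⟩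
    suc h    ∎)
    where open ≤-Reasoning

  height-zero-leaf : ∀ {v c} → HeightAtMost 0 v → p c ≢ just v
  height-zero-leaf {v} {c} hv pc with hv c 1 (anc-suc 0 c v pc)
  ... | ()

  height : ℕ
  height = max-over depth

  height-bound : ∀ v → HeightAtMost height v
  height-bound v z m e = ≤-trans (m≤m+n m (depth v)) (≤-trans
    (depth-bound (trans (anc-+ m (depth v) z v e) (proj₂ (reach v)))) (≤-max-over depth z))

  walk-to-top : ∀ h v → HeightAtMost h v → ∀ x → InSub p v x → Walk E (InSub p v) x v
  walk-to-top h v hv x vx with x ≟F v
  ... | yes refl = here (InSub-refl v)
  ... | no x≢v with child-toward vx x≢v
  walk-to-top zero v hv x vx | no _ | c , pc , cx = ⊥-elim (height-zero-leaf hv pc)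
  walk-to-top (suc h) v hv x vx | no _ | c , pc , cx with hook c v pc
  ... | z , cz , adj =
    walk-++ (walk-mono (InSub-trans (InSub-child pc))
              (walk-++ (walk-to-top h c hc x cx) (walk-reverse (walk-to-top h c hc z cz))))
            (cons (InSub-trans (InSub-child pc) cz) adj (here (InSub-refl v)))
    where hc = height-child hv pc

  subtree-connected : ∀ v → Connected E (InSub p v)
  subtree-connected v x y vx vy =
    walk-++ (walk-to-top height v (height-bound v) x vx)
            (walk-reverse (walk-to-top height v (height-bound v) y vy))

  child-component : ∀ (U : Pred (Fin n) 0ℓ) v → (∀ x → (U x → InSub p v x) × (InSub p v x → U x)) →
                    ∀ c → p c ≡ just v → IsComponent E (λ x → U x × x ≢ v) (InSub p c)
  child-component U v U≡Tv c pc = inside , (c , InSub-refl c) , subtree-connected c , closed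
    where
    inside : ∀ x → InSub p c x → U x × x ≢ v
    inside x cx = proj₂ (U≡Tv x) (InSub-trans (InSub-child pc) cx) , λ { refl → acyclic pc cx }
    closed : ∀ x y → InSub p c x → U y × y ≢ v → Adj E x y → InSub p c y
    closed x y cx (Uy , y≢v) adj with edge-comparable x y adj
    ... | inj₁ xy = InSub-trans cx xy
    ... | inj₂ yx with ancestors-comparable yx cx
    ...   | inj₂ cy = cy
    ...   | inj₁ yc with c ≟F y
    ...     | yes refl = InSub-refl c
    ...     | no c≢y = ⊥-elim (y≢v (sym (InSub-antisym (proj₁ (U≡Tv y) Uy) (InSub-parent yc c≢y pc))))

  STT-below : ∀ h (U : Pred (Fin n) 0ℓ) v → (∀ x → (U x → InSub p v x) × (InSub p v x → U x)) →
              HeightAtMost h v → STT E p U v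
  STT-below zero U v U≡Tv hv = node (proj₂ (U≡Tv v) (InSub-refl v)) U≡Tv
    (λ c pc → ⊥-elim (height-zero-leaf hv pc))
  STT-below (suc h) U v U≡Tv hv = node (proj₂ (U≡Tv v) (InSub-refl v)) U≡Tv
    (λ c pc → child-component U v U≡Tv c pc ,
              STT-below h (InSub p c) c (λ x → (λ cx → cx) , (λ cx → cx)) (height-child hv pc))

  isSTT : IsSTT E p
  isSTT = root , root-parent ,
          STT-below height (λ _ → ⊤) root (λ x → (λ _ → reach x) , (λ _ → tt)) (height-bound root)

  δ? : ∀ v → Decidable (δ E p v)
  δ? v y = ¬? (InSub? v y) ×-dec any? (λ z → InSub? v z ×-dec Adj? z y)

  step-toward : Fin n → Fin n → Fin n
  step-toward u w with any? (λ c → ≡-decM _≟F_ (p c) (just u) ×-dec InSub? c w)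
  ... | yes (c , _) = c
  ... | no _ = u

  step-toward-child : ∀ {u w c} → p c ≡ just u → InSub p c w → step-toward u w ≡ c
  step-toward-child {u} {w} {c} pc cw with any? (λ c → ≡-decM _≟F_ (p c) (just u) ×-dec InSub? c w)
  ... | yes (c' , pc' , c'w) = child-toward-unique pc' pc c'w cw
  ... | no none = ⊥-elim (none (c , pc , cw))

  -- For an edge between u and a descendant z, the child c of u above z: the
  -- edge attaches the subtree T_c to its parent.
  edge-child : Fin n × Fin n → Fin n
  edge-child (s , t) with InSub? s t
  ... | yes _ = step-toward s t
  ... | no _ = step-toward t s

  edge-child-≡ : ∀ {u z c} e → (e ≡ (z , u) ⊎ e ≡ (u , z)) → p c ≡ just u → InSub p c z →
                 edge-child e ≡ c
  edge-child-≡ {u} {z} .(u , z) (inj₂ refl) pc cz with InSub? u z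
  ... | yes _ = step-toward-child pc cz
  ... | no ¬uz = ⊥-elim (¬uz (InSub-trans (InSub-child pc) cz))
  edge-child-≡ {u} {z} .(z , u) (inj₁ refl) pc cz with InSub? z u
  ... | yes zu = ⊥-elim (acyclic pc (InSub-trans cz zu))
  ... | no _ = step-toward-child pc cz

  non-root-count : n ≡ suc (count (∁? (_≟F root)))
  non-root-count = begin
    n                                                ≡⟨ sym (count-compl (_≟F root)) ⟩
    count (_≟F root) + count (∁? (_≟F root))         ≡⟨ cong (_+ count (∁? (_≟F root))) (count-singleton root) ⟩
    suc (count (∁? (_≟F root)))                      ∎
    where open ≡-Reasoning

  -- Every non-root node is hooked by an edge, so when S has only n - 1 edges no
  -- edge is to spare: two hooks of one subtree would leave n - 2 edges
  -- hooking all n - 1 non-root nodes.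
  hook-unique : length E ≡ n ∸ 1 → ∀ {u c z₁ z₂} → p c ≡ just u → InSub p c z₁ → InSub p c z₂ →
                Adj E z₁ u → Adj E z₂ u → z₁ ≡ z₂
  hook-unique edges {u} {c} {z₁} {z₂} pc cz₁ cz₂ adj₁ adj₂ with z₁ ≟F z₂
  ... | yes z₁≡z₂ = z₁≡z₂
  ... | no z₁≢z₂ with Adj⇒edge adj₁ | Adj⇒edge adj₂
  ... | e₁ , e₁∈E , is₁ | e₂ , e₂∈E , is₂ = ⊥-elim (<-irrefl refl too-few-edges)
    where
    E′ = E ─ e₂∈E
    not-parent : ∀ {z} → InSub p c z → z ≢ u
    not-parent cz refl = acyclic pc cz
    e₁≢e₂ : e₁ ≢ e₂
    e₁≢e₂ = edges-≢ is₁ is₂ z₁≢z₂ (not-parent cz₁) (not-parent cz₂)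
    covers : ∀ v → ¬ v ≡ root → v ∈ map edge-child E′
    covers v v≢root with parent-inside (reach v) v≢root
    ... | w , pv , _ with hook v w pv
    ... | z , vz , adj with Adj⇒edge adj
    ... | e , e∈E , is with ≡-decP _≟F_ _≟F_ e e₂
    ...   | yes refl = subst (_∈ map edge-child E′)
                         (trans (edge-child-≡ e₁ is₁ pc cz₁)
                           (trans (sym (edge-child-≡ e₂ is₂ pc cz₂)) (edge-child-≡ e is pv vz)))
                         (∈-map⁺ edge-child (∈-─ E e₂∈E e₁∈E e₁≢e₂))
    ...   | no e≢e₂ = subst (_∈ map edge-child E′) (edge-child-≡ e is pv vz)
                        (∈-map⁺ edge-child (∈-─ E e₂∈E e∈E e≢e₂))
    too-few-edges : suc (length E′) ≤ length E′
    too-few-edges = begin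
      suc (length E′)              ≡⟨ sym (length-removeAt′ E (index e₂∈E)) ⟩
      length E                     ≡⟨ edges ⟩
      n ∸ 1                        ≡⟨ cong (_∸ 1) non-root-count ⟩
      count (∁? (_≟F root))        ≤⟨ AtMost⇒count≤ (∁? (_≟F root))
                                        (map edge-child E′ , ≤-reflexive (length-map edge-child E′) , covers) ⟩
      length E′                    ∎
      where open ≤-Reasoning

  δ-child⊆ : ∀ {x a} → p x ≡ just a → ∀ {y} → δ E p x y → y ≡ a ⊎ δ E p a y
  δ-child⊆ {x} {a} px {y} (¬xy , z , xz , adj) with y ≟F a
  ... | yes y≡a = inj₁ y≡a
  ... | no y≢a with InSub? a y
  ...   | no ¬ay = inj₂ (¬ay , z , InSub-trans (InSub-child px) xz , adj)
  ...   | yes ay with edge-comparable z y adj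
  ...     | inj₁ zy = ⊥-elim (¬xy (InSub-trans xz zy))
  ...     | inj₂ yz with ancestors-comparable yz xz
  ...       | inj₂ xy = ⊥-elim (¬xy xy)
  ...       | inj₁ yx with x ≟F y
  ...         | yes refl = ⊥-elim (¬xy (InSub-refl x))
  ...         | no x≢y = ⊥-elim (y≢a (sym (InSub-antisym ay (InSub-parent yx x≢y px))))

  -- δ(T_x) ⊆ {a} ∪ δ(T_a), so if δ(T_x) is the larger one, no element of δ(T_a) can be missing from it.
  δ-parent⊆δ-child : ∀ {x a} → p x ≡ just a → count (δ? a) < count (δ? x) → δ E p a ⊆ δ E p x
  δ-parent⊆δ-child {x} {a} px a<x {u} au with δ? x u
  ... | yes xu = xu
  ... | no ¬xu = ⊥-elim (<-irrefl refl (≤-trans a<x (begin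
    count (δ? x)                                  ≤⟨ count-mono (δ? x) ((_≟F a) ∪? remove? (δ? a) u) into ⟩
    count ((_≟F a) ∪? remove? (δ? a) u)           ≤⟨ count-∪ (_≟F a) (remove? (δ? a) u) ⟩
    count (_≟F a) + count (remove? (δ? a) u)      ≡⟨ cong (_+ count (remove? (δ? a) u)) (count-singleton a) ⟩
    suc (count (remove? (δ? a) u))                ≡⟨ sym (count-remove (δ? a) au) ⟩
    count (δ? a)                                  ∎)))
    where
    open ≤-Reasoning
    into : ∀ {y} → δ E p x y → y ≡ a ⊎ (δ E p a y × y ≢ u)
    into {y} xy with δ-child⊆ px xy
    ... | inj₁ y≡a = inj₁ y≡a
    ... | inj₂ ay = inj₂ (ay , λ { refl → ¬xu xy })

  Bad : ℕ → Fin n → Set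
  Bad m v = m < count (δ? v)

  Bad? : ∀ m → Decidable (Bad m)
  Bad? m v = m <? count (δ? v)

  depth-< : ∀ {w v} → InSub p w v → w ≢ v → depth w < depth v
  depth-< (zero , refl) w≢v = ⊥-elim (w≢v refl)
  depth-< {w} {v} (suc i , e) _ = ≤-trans (s≤s (m≤n+m (depth w) i))
    (depth-bound (trans (anc-+ (suc i) (depth w) v w e) (proj₂ (reach w))))

  δ-ancestor : ∀ {x y} → δ E p x y → InSub p y x × y ≢ x
  δ-ancestor {x} {y} (¬xy , z , xz , adj) with edge-comparable z y adj
  ... | inj₁ zy = ⊥-elim (¬xy (InSub-trans xz zy))
  ... | inj₂ yz with ancestors-comparable yz xz
  ...   | inj₁ yx = yx , λ { refl → ¬xy (InSub-refl y) }
  ...   | inj₂ xy = ⊥-elim (¬xy xy)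

  module _ (m : ℕ) where

    root-good : ¬ Bad m root
    root-good bad = n≮0 (≤-trans bad (≤-reflexive
      (count-none (δ? root) (λ y root-y → proj₁ root-y (reach y)))))

    topmost-bad : ∀ d v → depth v ≤ d → Bad m v →
                  ∃ λ x → Bad m x × (∀ w → InSub p w x → w ≢ x → ¬ Bad m w)
    topmost-bad d v v≤d bad with any? (λ w → InSub? w v ×-dec ¬? (w ≟F v) ×-dec Bad? m w)
    ... | no none = v , bad , λ w wv w≢v bad-w → none (w , wv , w≢v , bad-w)
    ... | yes (w , wv , w≢v , bad-w) with d
    ...   | zero = ⊥-elim (<⇒≱ (depth-< wv w≢v) (≤-trans v≤d z≤n))
    ...   | suc d′ = topmost-bad d′ w (≤-pred (≤-trans (depth-< wv w≢v) v≤d)) bad-w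

    -- For a topmost bad node x, the more than m nodes of δ(T_x) are good ancestors of x.
    count-bad : count (Bad? m) ≤ n ∸ suc m
    count-bad with any? (Bad? m)
    ... | no none = ≤-trans (≤-reflexive (count-none (Bad? m) (λ v bad → none (v , bad)))) z≤n
    ... | yes (v , bad) with topmost-bad (depth v) v ≤-refl bad
    ... | x , bad-x , above-good = begin
      count (Bad? m)                         ≡⟨ sym (m+n∸n≡m _ (count (∁? (Bad? m)))) ⟩
      count (Bad? m) + count (∁? (Bad? m))
        ∸ count (∁? (Bad? m))                ≡⟨ cong (_∸ count (∁? (Bad? m))) (count-compl (Bad? m)) ⟩
      n ∸ count (∁? (Bad? m))                ≤⟨ ∸-monoʳ-≤ n many-good ⟩
      n ∸ suc m                              ∎
      where
      open ≤-Reasoning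
      many-good : suc m ≤ count (∁? (Bad? m))
      many-good = ≤-trans bad-x (count-mono (δ? x) (∁? (Bad? m)) (λ xy → uncurry (above-good _) (δ-ancestor xy)))

    bad-below-good : ∀ {v} → Bad m v → ∃ λ x → ∃ λ a → p x ≡ just a × Bad m x × count (δ? a) ≤ m
    bad-below-good {v} bad with topmost-bad (depth v) v ≤-refl bad
    ... | x , bad-x , above-good with parent-inside (reach x) (λ { refl → root-good bad-x })
    ... | a , px , _ = x , a , px , bad-x ,
                       ≮⇒≥ (above-good a (InSub-child px) (λ { refl → acyclic px (InSub-refl a) }))

module Rotate {n : ℕ} {E : List (Fin n × Fin n)} {p : Parent n} (T : SearchTree E p)
              {x a : Fin n} (px : p x ≡ just a) where
  open SearchTreeTheory T
  open Graph E
  open Counting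

  Moves : Fin n → Set
  Moves z = ∃ λ w → InSub p z w × Adj E w a

  MovingChild : Fin n → Set
  MovingChild z = p z ≡ just x × Moves z

  MovingChild? : ∀ z → Dec (MovingChild z)
  MovingChild? z = ≡-decM _≟F_ (p z) (just x) ×-dec any? (λ w → InSub? z w ×-dec Adj? w a)

  rotated-parent : ∀ z → Dec (z ≡ x) → Dec (z ≡ a) → Dec (MovingChild z) → Maybe (Fin n)
  rotated-parent z (yes _) _ _ = p a
  rotated-parent z (no _) (yes _) _ = just x
  rotated-parent z (no _) (no _) (yes _) = just a
  rotated-parent z (no _) (no _) (no _) = p z

  p′ : Parent n
  p′ z = rotated-parent z (z ≟F x) (z ≟F a) (MovingChild? z)

  a≢x : a ≢ x
  a≢x refl = acyclic px (InSub-refl x)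

  child≢x : ∀ {z} → p z ≡ just x → z ≢ x
  child≢x pz refl = acyclic pz (InSub-refl x)

  child≢a : ∀ {z} → p z ≡ just x → z ≢ a
  child≢a pz refl = acyclic px (InSub-child pz)

  p′-x : p′ x ≡ p a
  p′-x with x ≟F x
  ... | yes _ = refl
  ... | no x≢x = ⊥-elim (x≢x refl)

  p′-a : p′ a ≡ just x
  p′-a with a ≟F x | a ≟F a
  ... | yes a≡x | _ = ⊥-elim (a≢x a≡x)
  ... | no _ | yes _ = refl
  ... | no _ | no a≢a = ⊥-elim (a≢a refl)

  p′-moving : ∀ {z} → z ≢ x → z ≢ a → MovingChild z → p′ z ≡ just a
  p′-moving {z} z≢x z≢a mz with z ≟F x | z ≟F a | MovingChild? z
  ... | yes z≡x | _ | _ = ⊥-elim (z≢x z≡x)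
  ... | no _ | yes z≡a | _ = ⊥-elim (z≢a z≡a)
  ... | no _ | no _ | yes _ = refl
  ... | no _ | no _ | no ¬mz = ⊥-elim (¬mz mz)

  p′-other : ∀ {z} → z ≢ x → z ≢ a → ¬ MovingChild z → p′ z ≡ p z
  p′-other {z} z≢x z≢a ¬mz with z ≟F x | z ≟F a | MovingChild? z
  ... | yes z≡x | _ | _ = ⊥-elim (z≢x z≡x)
  ... | no _ | yes z≡a | _ = ⊥-elim (z≢a z≡a)
  ... | no _ | no _ | yes mz = ⊥-elim (¬mz mz)
  ... | no _ | no _ | no _ = refl

  data View (z : Fin n) : Set where
    at-x : z ≡ x → View z
    at-a : z ≡ a → View z
    moving : z ≢ x → z ≢ a → MovingChild z → View z
    other : z ≢ x → z ≢ a → ¬ MovingChild z → View z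

  view : ∀ z → View z
  view z with z ≟F x | z ≟F a | MovingChild? z
  ... | yes z≡x | _ | _ = at-x z≡x
  ... | no z≢x | yes z≡a | _ = at-a z≡a
  ... | no z≢x | no z≢a | yes mz = moving z≢x z≢a mz
  ... | no z≢x | no z≢a | no ¬mz = other z≢x z≢a ¬mz

  module A′ = Ancestry p′

  subtree-other : ∀ {v} → v ≢ x → v ≢ a → InSub p′ v ≐ InSub p v
  subtree-other {v} v≢x v≢a = (λ {z} → to z) , (λ {z} → from z)
    where
    to : ∀ z → InSub p′ v z → InSub p v z
    to = A′.InSub-ind (InSub p v) (InSub-refl v) closed
      where
      closed : ∀ z w → p′ z ≡ just w → InSub p′ v w → InSub p v w → InSub p v z
      closed z w e _ vw with view z
      ... | at-x refl = InSub-step (InSub-step vw (trans (sym p′-x) e)) px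
      ... | at-a refl with just-unique p′-a e
      ...   | refl = InSub-parent vw (λ e′ → v≢x (sym e′)) px
      closed z w e _ vw | moving z≢x z≢a mz with just-unique (p′-moving z≢x z≢a mz) e
      ...   | refl = InSub-step (InSub-step vw px) (proj₁ mz)
      closed z w e _ vw | other z≢x z≢a ¬mz = InSub-step vw (trans (sym (p′-other z≢x z≢a ¬mz)) e)
    from : ∀ z → InSub p v z → InSub p′ v z
    from = InSub-ind (InSub p′ v) (A′.InSub-refl v) closed
      where
      closed : ∀ z w → p z ≡ just w → InSub p v w → InSub p′ v w → InSub p′ v z
      closed z w e _ vw with view z
      ... | at-x refl with just-unique px e
      ...   | refl = A′.InSub-parent vw (λ e′ → v≢a (sym e′)) p′-a
      closed z w e _ vw | at-a refl = A′.InSub-step (A′.InSub-step vw (trans p′-x e)) p′-a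
      closed z w e _ vw | moving z≢x z≢a mz with just-unique (proj₁ mz) e
      ...   | refl = A′.InSub-step (A′.InSub-step vw p′-a) (p′-moving z≢x z≢a mz)
      closed z w e _ vw | other z≢x z≢a ¬mz = A′.InSub-step vw (trans (p′-other z≢x z≢a ¬mz) e)

  a-above-x : InSub p a x
  a-above-x = InSub-child px

  x-above-a : InSub p′ x a
  x-above-a = A′.InSub-child p′-a

  subtree-x : InSub p′ x ≐ InSub p a
  subtree-x = (λ {z} → to z) , (λ {z} → from z)
    where
    to : ∀ z → InSub p′ x z → InSub p a z
    to = A′.InSub-ind (InSub p a) a-above-x closed
      where
      closed : ∀ z w → p′ z ≡ just w → InSub p′ x w → InSub p a w → InSub p a z
      closed z w e _ aw with view z
      ... | at-x refl = a-above-x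
      ... | at-a refl = InSub-refl a
      ... | moving _ _ mz = InSub-step a-above-x (proj₁ mz)
      ... | other z≢x z≢a ¬mz = InSub-step aw (trans (sym (p′-other z≢x z≢a ¬mz)) e)
    from : ∀ z → InSub p a z → InSub p′ x z
    from = InSub-ind (InSub p′ x) x-above-a closed
      where
      closed : ∀ z w → p z ≡ just w → InSub p a w → InSub p′ x w → InSub p′ x z
      closed z w e _ xw with view z
      ... | at-x refl = A′.InSub-refl x
      ... | at-a refl = x-above-a
      ... | moving z≢x z≢a mz = A′.InSub-step x-above-a (p′-moving z≢x z≢a mz)
      ... | other z≢x z≢a ¬mz = A′.InSub-step xw (trans (p′-other z≢x z≢a ¬mz) e)

  RotatedSubtreeOfA : Fin n → Set
  RotatedSubtreeOfA z = (InSub p a z × ¬ InSub p x z) ⊎ (∃ λ y → MovingChild y × InSub p y z)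

  moving-below-a : ∀ {y} → MovingChild y → InSub p a y
  moving-below-a my = InSub-step a-above-x (proj₁ my)

  RotatedSubtreeOfA⊆InSub-a : RotatedSubtreeOfA ⊆ InSub p a
  RotatedSubtreeOfA⊆InSub-a (inj₁ (az , _)) = az
  RotatedSubtreeOfA⊆InSub-a (inj₂ (y , my , yz)) = InSub-trans (moving-below-a my) yz

  subtree-a⁺ : ∀ z → InSub p′ a z → RotatedSubtreeOfA z
  subtree-a⁺ = A′.InSub-ind RotatedSubtreeOfA (inj₁ (InSub-refl a , acyclic px)) closed
    where
    closed : ∀ z w → p′ z ≡ just w → InSub p′ a w → RotatedSubtreeOfA w → RotatedSubtreeOfA z
    closed z w e _ rw with view z
    ... | at-x refl with rw
    ...   | inj₁ (aw , _) = ⊥-elim (acyclic (trans (sym p′-x) e) aw)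
    ...   | inj₂ ryw = ⊥-elim (acyclic (trans (sym p′-x) e) (RotatedSubtreeOfA⊆InSub-a (inj₂ ryw)))
    closed z w e _ rw | at-a refl = inj₁ (InSub-refl a , acyclic px)
    closed z w e _ rw | moving _ _ mz = inj₂ (z , mz , InSub-refl z)
    closed z w e _ (inj₁ (aw , ¬xw)) | other z≢x z≢a ¬mz =
      let pz = trans (sym (p′-other z≢x z≢a ¬mz)) e in
      inj₁ (InSub-step aw pz , λ xz → ¬xw (InSub-parent xz z≢x pz))
    closed z w e _ (inj₂ (y , my , yw)) | other z≢x z≢a ¬mz =
      inj₂ (y , my , InSub-step yw (trans (sym (p′-other z≢x z≢a ¬mz)) e))

  subtree-a⁻-outside-x : ∀ z → InSub p a z → ¬ InSub p x z → InSub p′ a z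
  subtree-a⁻-outside-x = InSub-ind (λ z → ¬ InSub p x z → InSub p′ a z) (λ _ → A′.InSub-refl a) closed
    where
    closed : ∀ z w → p z ≡ just w → InSub p a w → (¬ InSub p x w → InSub p′ a w) →
             ¬ InSub p x z → InSub p′ a z
    closed z w e _ aw ¬xz with view z
    ... | at-x refl = ⊥-elim (¬xz (InSub-refl x))
    ... | at-a refl = A′.InSub-refl a
    ... | moving _ _ mz = ⊥-elim (¬xz (InSub-child (proj₁ mz)))
    ... | other z≢x z≢a ¬mz =
      A′.InSub-step (aw (λ xw → ¬xz (InSub-step xw e))) (trans (p′-other z≢x z≢a ¬mz) e)

  subtree-a⁻-moving : ∀ {y} → MovingChild y → ∀ z → InSub p y z → InSub p′ a z
  subtree-a⁻-moving {y} my =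
    InSub-ind (InSub p′ a) (A′.InSub-child (p′-moving (child≢x (proj₁ my)) (child≢a (proj₁ my)) my)) closed
    where
    closed : ∀ z w → p z ≡ just w → InSub p y w → InSub p′ a w → InSub p′ a z
    closed z w e yw aw with view z
    ... | at-x refl with just-unique px e
    ...   | refl = ⊥-elim (acyclic (proj₁ my) (InSub-step yw px))
    closed z w e yw aw | at-a refl = A′.InSub-refl a
    closed z w e yw aw | moving z≢x z≢a mz = A′.InSub-child (p′-moving z≢x z≢a mz)
    closed z w e yw aw | other z≢x z≢a ¬mz = A′.InSub-step aw (trans (p′-other z≢x z≢a ¬mz) e)

  subtree-a : InSub p′ a ≐ RotatedSubtreeOfA
  subtree-a = (λ {z} → subtree-a⁺ z) , λ where
    (inj₁ (az , ¬xz)) → subtree-a⁻-outside-x _ az ¬xz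
    (inj₂ (y , my , yz)) → subtree-a⁻-moving my _ yz

  root≢x : root ≢ x
  root≢x refl = nothing≢just (trans (sym root-parent) px)

  root-not-moving : ¬ MovingChild root
  root-not-moving mr = nothing≢just (trans (sym root-parent) (proj₁ mr))

  hook′ : ∀ c r → p′ c ≡ just r → ∃ λ z → InSub p′ c z × Adj E z r
  hook′ c r e with view c
  ... | at-x refl with hook a r (trans (sym p′-x) e)
  ...   | z , az , adj = z , proj₂ subtree-x az , adj
  hook′ c r e | at-a refl with just-unique p′-a e
  ... | refl with any? MovingChild?
  ...   | yes (y , my) with hook y x (proj₁ my)
  ...     | z , yz , adj = z , subtree-a⁻-moving my z yz , adj
  hook′ c r e | at-a refl | refl | no no-moving with hook x a px
  ...     | z , xz , adj with z ≟F x
  ...       | yes refl = a , A′.InSub-refl a , Adj-sym adj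
  ...       | no z≢x with child-toward xz z≢x
  ...         | c′ , pc′ , c′z = ⊥-elim (no-moving (c′ , pc′ , z , c′z , adj))
  hook′ c r e | moving c≢x c≢a mc with just-unique (p′-moving c≢x c≢a mc) e
  ... | refl with proj₂ mc
  ...   | z , cz , adj = z , proj₂ (subtree-other c≢x c≢a) cz , adj
  hook′ c r e | other c≢x c≢a ¬mc with hook c r (trans (sym (p′-other c≢x c≢a ¬mc)) e)
  ... | z , cz , adj = z , proj₂ (subtree-other c≢x c≢a) cz , adj

  edge-downward : ∀ u w → InSub p u w → Adj E u w → InSub p′ u w ⊎ InSub p′ w u
  edge-downward u w uw adj with view u
  ... | at-x refl = inj₁ (proj₂ subtree-x (InSub-trans a-above-x uw))
  ... | other u≢x u≢a _ = inj₁ (proj₂ (subtree-other u≢x u≢a) uw)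
  ... | moving u≢x u≢a _ = inj₁ (proj₂ (subtree-other u≢x u≢a) uw)
  ... | at-a refl with InSub? x w
  ...   | no ¬xw = inj₁ (subtree-a⁻-outside-x w uw ¬xw)
  ...   | yes xw with w ≟F x
  ...     | yes refl = inj₂ x-above-a
  ...     | no w≢x with child-toward xw w≢x
  ...       | c , pc , cw = inj₁ (subtree-a⁻-moving (pc , w , cw , Adj-sym adj) w cw)

  edge-comparable′ : ∀ u w → Adj E u w → InSub p′ u w ⊎ InSub p′ w u
  edge-comparable′ u w adj with edge-comparable u w adj
  ... | inj₁ uw = edge-downward u w uw adj
  ... | inj₂ wu with edge-downward w u wu (Adj-sym adj)
  ...   | inj₁ h = inj₂ h
  ...   | inj₂ h = inj₁ h

  rotated-SearchTree : SearchTree E p′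
  rotated-SearchTree with a ≟F root
  ... | yes refl = record
    { root = x ; root-parent = trans p′-x root-parent ; reach = λ z → proj₂ subtree-x (reach z)
    ; hook = hook′ ; edge-comparable = edge-comparable′ }
  ... | no a≢root = record
    { root = root
    ; root-parent = trans (p′-other root≢x (λ e → a≢root (sym e)) root-not-moving) root-parent
    ; reach = λ z → proj₂ (subtree-other root≢x (λ e → a≢root (sym e))) (reach z)
    ; hook = hook′ ; edge-comparable = edge-comparable′ }

  rotation : Rotation E p p′
  rotation = x , a , px , p′-a , p′-x , children , others
    where
    children : ∀ y → p y ≡ just x → (Moves y → p′ y ≡ just a) × (¬ Moves y → p′ y ≡ just x)
    children y py = (λ my → p′-moving (child≢x py) (child≢a py) (py , my)) ,
                    (λ ¬my → trans (p′-other (child≢x py) (child≢a py) (λ m → ¬my (proj₂ m))) py)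
    others : ∀ z → z ≢ x → z ≢ a → p z ≢ just x → p′ z ≡ p z
    others z z≢x z≢a pz≢x = p′-other z≢x z≢a (λ m → pz≢x (proj₁ m))

  module T′ = SearchTreeTheory rotated-SearchTree

  δ′-other : ∀ {v} → v ≢ x → v ≢ a → δ E p′ v ≐ δ E p v
  δ′-other v≢x v≢a = δ-≐ (subtree-other v≢x v≢a)

  δ′-x : δ E p′ x ≐ δ E p a
  δ′-x = δ-≐ subtree-x

  module _ (edges : length E ≡ n ∸ 1) where

    moving-child-unique : ∀ {y₀ y₁} → MovingChild y₀ → MovingChild y₁ → y₀ ≡ y₁
    moving-child-unique (py₀ , w₀ , y₀w₀ , adj₀) (py₁ , w₁ , y₁w₁ , adj₁)
      with hook-unique edges px (InSub-trans (InSub-child py₀) y₀w₀) (InSub-trans (InSub-child py₁) y₁w₁)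
                       adj₀ adj₁
    ... | refl = child-toward-unique py₀ py₁ y₀w₀ y₁w₁

    -- A node y of δ(T′_a) other than x cannot lie in T_a, and if it lies above a
    -- then (the hook of T_a at y being unique) it is adjacent to T_x, hence to
    -- the subtree of a moving child.
    δ′-a⊆ : δ E p a ⊆ δ E p x → ∀ {y} → δ E p′ a y →
            y ≡ x ⊎ (∃ λ y₀ → MovingChild y₀ × δ E p y₀ y × y ≢ x × y ≢ a)
    δ′-a⊆ δa⊆δx {y} (¬a′y , z , a′z , adj) with y ≟F x
    ... | yes y≡x = inj₁ y≡x
    ... | no y≢x with subtree-a⁺ z a′z | InSub? a y
    ...   | rz | yes ay = ⊥-elim (inside-a rz)
      where
      ¬ry : ¬ RotatedSubtreeOfA y
      ¬ry ry = ¬a′y (proj₂ subtree-a ry)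
      xy : InSub p x y
      xy with InSub? x y
      ... | yes xy = xy
      ... | no ¬xy = ⊥-elim (¬ry (inj₁ (ay , ¬xy)))
      toward = child-toward xy y≢x
      c = proj₁ toward
      pc = proj₁ (proj₂ toward)
      cy = proj₂ (proj₂ toward)
      ¬mc : ¬ MovingChild c
      ¬mc mc = ¬ry (inj₂ (c , mc , cy))
      inside-a : ¬ RotatedSubtreeOfA z
      inside-a (inj₁ (az , ¬xz)) with edge-comparable z y adj
      ... | inj₂ yz = ¬xz (InSub-trans xy yz)
      ... | inj₁ zy with ancestors-comparable zy xy
      ...   | inj₂ xz = ¬xz xz
      ...   | inj₁ zx with z ≟F a
      ...     | yes refl = ¬mc (pc , y , cy , Adj-sym adj)
      ...     | no z≢a with z ≟F x
      ...       | yes refl = ¬xz (InSub-refl x)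
      ...       | no z≢x = z≢a (sym (InSub-antisym az (InSub-parent zx (λ e → z≢x (sym e)) px)))
      inside-a (inj₂ (y₀ , my₀ , y₀z)) with edge-comparable z y adj
      ... | inj₁ zy = ¬ry (inj₂ (y₀ , my₀ , InSub-trans y₀z zy))
      ... | inj₂ yz =
        ¬mc (subst MovingChild (sym (child-toward-unique pc (proj₁ my₀) (InSub-trans cy yz) y₀z)) my₀)
    δ′-a⊆ δa⊆δx {y} (¬a′y , z , a′z , adj) | no y≢x | rz | no ¬ay =
      conclude rz (hook-unique edges pcy cz cz₁ adj adj₁)
      where
      az = RotatedSubtreeOfA⊆InSub-a rz
      xy = δa⊆δx (¬ay , z , az , adj)
      z₁ = proj₁ (proj₂ xy)
      xz₁ = proj₁ (proj₂ (proj₂ xy))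
      adj₁ = proj₂ (proj₂ (proj₂ xy))
      yz : InSub p y z
      yz with edge-comparable z y adj
      ... | inj₁ zy = ⊥-elim (¬ay (InSub-trans az zy))
      ... | inj₂ yz = yz
      toward = child-toward yz (λ { refl → ¬ay az })
      c = proj₁ toward
      pcy = proj₁ (proj₂ toward)
      cz = proj₂ (proj₂ toward)
      cz₁ : InSub p c z₁
      cz₁ with ancestors-comparable cz az
      ... | inj₁ ca = InSub-trans ca (InSub-trans a-above-x xz₁)
      ... | inj₂ ac with c ≟F a
      ...   | yes c≡a = subst (λ t → InSub p t z₁) (sym c≡a) (InSub-trans a-above-x xz₁)
      ...   | no c≢a = ⊥-elim (¬ay (InSub-parent ac c≢a pcy))
      conclude : RotatedSubtreeOfA z → z ≡ z₁ →
                 y ≡ x ⊎ (∃ λ y₀ → MovingChild y₀ × δ E p y₀ y × y ≢ x × y ≢ a)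
      conclude (inj₁ (_ , ¬xz)) z≡z₁ = ⊥-elim (¬xz (subst (InSub p x) (sym z≡z₁) xz₁))
      conclude (inj₂ (y₀ , my₀ , y₀z)) _ =
        inj₂ (y₀ , my₀ , ((λ y₀y → ¬ay (InSub-trans (moving-below-a my₀) y₀y)) , z , y₀z , adj) , y≢x ,
              λ { refl → ¬ay (InSub-refl a) })

    count-δ′-a : ∀ {m} → 1 ≤ m → KCut E (suc m) p → δ E p a ⊆ δ E p x → count (T′.δ? a) ≤ m
    count-δ′-a {m} 1≤m cut δa⊆δx with any? MovingChild?
    ... | no no-moving = begin
      count (T′.δ? a)     ≤⟨ count-mono (T′.δ? a) (_≟F x) only-x ⟩
      count (_≟F x)       ≡⟨ count-singleton x ⟩
      1                   ≤⟨ 1≤m ⟩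
      m                   ∎
      where
      open ≤-Reasoning
      only-x : δ E p′ a ⊆ (_≡ x)
      only-x a′y with δ′-a⊆ δa⊆δx a′y
      ... | inj₁ y≡x = y≡x
      ... | inj₂ (y₀ , my₀ , _) = ⊥-elim (no-moving (y₀ , my₀))
    ... | yes (y₀ , my₀@(py₀ , w₀ , y₀w₀ , adj₀)) = ≤-pred (begin
      suc (count (T′.δ? a))         ≤⟨ s≤s (count-mono (T′.δ? a) ((_≟F x) ∪? rest?) into) ⟩
      suc (count ((_≟F x) ∪? rest?)) ≤⟨ s≤s (count-∪ (_≟F x) rest?) ⟩
      suc (count (_≟F x) + count rest?) ≡⟨ cong (λ c → suc (c + count rest?)) (count-singleton x) ⟩
      suc (suc (count rest?))       ≡⟨ sym (trans (count-remove (δ? y₀) x∈δy₀)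
                                                   (cong suc (count-remove (remove? (δ? y₀) x) a∈δy₀))) ⟩
      count (δ? y₀)                 ≤⟨ AtMost⇒count≤ (δ? y₀) (cut y₀) ⟩
      suc m                         ∎)
      where
      open ≤-Reasoning
      rest? = remove? (remove? (δ? y₀) x) a
      x∈δy₀ : δ E p y₀ x
      x∈δy₀ = acyclic py₀ , hook y₀ x py₀
      a∈δy₀ : δ E p y₀ a × a ≢ x
      a∈δy₀ = ((λ y₀a → acyclic py₀ (InSub-step y₀a px)) , w₀ , y₀w₀ , adj₀) , a≢x
      into : ∀ {y} → δ E p′ a y → y ≡ x ⊎ ((δ E p y₀ y × y ≢ x) × y ≢ a)
      into a′y with δ′-a⊆ δa⊆δx a′y
      ... | inj₁ y≡x = inj₁ y≡x
      ... | inj₂ (y₁ , my₁ , y₁y , y≢x , y≢a) with moving-child-unique my₀ my₁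
      ...   | refl = inj₂ ((y₁y , y≢x) , y≢a)

    module _ {m} (1≤m : 1 ≤ m) (cut : KCut E (suc m) p) (x-bad : Bad m x) (a-good : count (δ? a) ≤ m) where

      δ-a⊆δ-x : δ E p a ⊆ δ E p x
      δ-a⊆δ-x = δ-parent⊆δ-child px (≤-<-trans a-good x-bad)

      count-δ′-other : ∀ {v} → v ≢ x → v ≢ a → count (T′.δ? v) ≡ count (δ? v)
      count-δ′-other v≢x v≢a = count-ext (T′.δ? _) (δ? _) (δ′-other v≢x v≢a)

      count-δ′-x : count (T′.δ? x) ≤ m
      count-δ′-x = ≤-trans (≤-reflexive (count-ext (T′.δ? x) (δ? a) δ′-x)) a-good

      rotated-KCut : KCut E (suc m) p′
      rotated-KCut v with view v
      ... | at-x refl = count≤⇒AtMost (T′.δ? x) (m≤n⇒m≤1+n count-δ′-x)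
      ... | at-a refl = count≤⇒AtMost (T′.δ? a) (m≤n⇒m≤1+n (count-δ′-a 1≤m cut δ-a⊆δ-x))
      ... | moving v≢x v≢a _ = count≤⇒AtMost (T′.δ? v)
              (≤-trans (≤-reflexive (count-δ′-other v≢x v≢a)) (AtMost⇒count≤ (δ? v) (cut v)))
      ... | other v≢x v≢a _ = count≤⇒AtMost (T′.δ? v)
              (≤-trans (≤-reflexive (count-δ′-other v≢x v≢a)) (AtMost⇒count≤ (δ? v) (cut v)))

      Bad-rotated : (λ v → Bad m v × v ≢ x) ≐ T′.Bad m
      Bad-rotated = (λ {v} → to v) , (λ {v} → from v)
        where
        to : ∀ v → Bad m v × v ≢ x → T′.Bad m v
        to v (bad , v≢x) with view v
        ... | at-x v≡x = ⊥-elim (v≢x v≡x)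
        ... | at-a refl = ⊥-elim (<⇒≱ bad a-good)
        ... | moving _ v≢a _ = ≤-trans bad (≤-reflexive (sym (count-δ′-other v≢x v≢a)))
        ... | other _ v≢a _ = ≤-trans bad (≤-reflexive (sym (count-δ′-other v≢x v≢a)))
        from : ∀ v → T′.Bad m v → Bad m v × v ≢ x
        from v bad with view v
        ... | at-x refl = ⊥-elim (<⇒≱ bad count-δ′-x)
        ... | at-a refl = ⊥-elim (<⇒≱ bad (count-δ′-a 1≤m cut δ-a⊆δ-x))
        ... | moving v≢x v≢a _ = ≤-trans bad (≤-reflexive (count-δ′-other v≢x v≢a)) , v≢x
        ... | other v≢x v≢a _ = ≤-trans bad (≤-reflexive (count-δ′-other v≢x v≢a)) , v≢x

      count-Bad-rotated : count (Bad? m) ≡ suc (count (T′.Bad? m))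
      count-Bad-rotated = trans (count-remove (Bad? m) x-bad)
                                (cong suc (count-ext (remove? (Bad? m) x) (T′.Bad? m) Bad-rotated))

module Improve {n : ℕ} {E : List (Fin n × Fin n)} (edges : length E ≡ n ∸ 1) {m : ℕ} (1≤m : 1 ≤ m) where
  open Counting
  module ST = SearchTreeTheory

  Improvable : Parent n → ℕ → Set₁
  Improvable p b = Σ (Parent n) λ p* → Σ ℕ λ steps →
    (steps ≤ b) ×
    RotSeq E (λ t → IsSTT E t × KCut E (suc m) t) p p* steps ×
    IsSTT E p* × KCut E m p*

  improve : ∀ b {p} (T : SearchTree E p) → KCut E (suc m) p →
            count (ST.Bad? T m) ≡ b → Improvable p b
  improve zero {p} T cut no-bad = p , 0 , z≤n , done (isSTT , cut) , isSTT , m-cut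
    where
    open SearchTreeTheory T
    m-cut : KCut E m p
    m-cut v with Bad? m v
    ... | no good = count≤⇒AtMost (δ? v) (≮⇒≥ good)
    ... | yes bad = ⊥-elim (0≢1+n (trans (sym no-bad) (count-remove (Bad? m) bad)))
  improve (suc b) {p} T cut bad-count = rotate-bad (ST.bad-below-good T m (proj₂ some-bad))
    where
    some-bad : ∃ (ST.Bad T m)
    some-bad = count-pos (ST.Bad? T m) (subst (0 <_) (sym bad-count) (s≤s z≤n))
    rotate-bad : (∃ λ x → ∃ λ a → p x ≡ just a × ST.Bad T m x × count (ST.δ? T a) ≤ m) →
                 Improvable p (suc b)
    rotate-bad (x , a , px , bad-x , good-a) = prepend
      (improve b R.rotated-SearchTree (R.rotated-KCut edges 1≤m cut bad-x good-a)
                 (suc-injective (trans (sym (R.count-Bad-rotated edges 1≤m cut bad-x good-a)) bad-count)))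
      where
      module R = Rotate T px
      prepend : Improvable R.p′ b → Improvable p (suc b)
      prepend (p* , steps , steps≤b , rotations , rest) =
        p* , suc steps , s≤s steps≤b , step (ST.isSTT T , cut) R.rotation rotations , rest

  improve-within : ∀ {p} (T : SearchTree E p) → KCut E (suc m) p → Improvable p (n ∸ suc m)
  improve-within T cut with improve _ T cut refl
  ... | p* , steps , steps≤bad , rest = p* , steps , ≤-trans steps≤bad (ST.count-bad T m) , rest

lemma10 : (n : ℕ) (E : List (Fin n × Fin n)) → IsTree E →
    (k : ℕ) → 2 ≤ k →
    (T : Parent n) → IsSTT E T → KCut E k T →
    Σ (Parent n) λ T' → Σ ℕ λ m →
      (m ≤ n ∸ k) ×
      RotSeq E (λ t → IsSTT E t × KCut E k t) T T' m ×
      IsSTT E T' × KCut E (k ∸ 1) T'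
lemma10 n E (S-connected , edges) .(suc m) (s≤s {n = m} 1≤m) T T-STT cut =
  Improve.improve-within edges 1≤m (IsSTT⇒SearchTree S-connected T-STT) cut
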